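{- Let $\mathcal{CP}$ be a non-extensible combinatorial torus cube packing in dimension $n$. (i) Every parameter $t$ of $\mathcal{CP}$ which occurs as $t$ in some coordinate of some cube of $\mathcal{CP}$ also occurs as $t+1$ in some cube of $\mathcal{CP}$. (ii) Let $C_1,\dots,C_k$ be cubes of $\mathcal{CP}$, let $\mathcal{CP}'=\mathcal{CP}\setminus\{C_1,\dots,C_k\}$, and let $C$ be a combinatorial torus cube which does not overlap with any cube of $\mathcal{CP}'$. Then the number of parameters of $C$ which do not occur in $\mathcal{CP}'$ is at most $k-1$.
   Context: A combinatorial torus cube in dimension $n$ is a formal cube $z+[0,1]^n$, $z=(z_1,\dots,z_n)$, where each $z_j$ is either $t$ or $t+1$ for a formal parameter $t$, parameters occurring in different coordinates being distinct. Two combinatorial torus cubes $z+[0,1]^n$, $z'+[0,1]^n$ are non-overlapping if there is a coordinate $j$ such that $z_j,z'_j$ involve the same parameter $t$ and $\{z_j,z'_j\}=\{t,t+1\}$. A combinatorial torus cube packing is a finite family of pairwise non-overlapping combinatorial torus cubes. It is non-extensible if it has fewer than $2^n$ cubes and no combinatorial torus cube (whose coordinates may use already occurring parameters or new parameters) can be added to it keeping pairwise non-overlap. -}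

module Defs where

open import Data.Nat using (ℕ; _<_; _^_)
open import Data.Nat.Properties using (_≟_)
open import Data.Bool using (Bool; true; false)
open import Data.Fin using (Fin)
open import Data.List using (List; length; filter; allFin)
open import Data.List.Relation.Unary.Any using (Any; any?)
open import Data.List.Relation.Unary.All using (All)
open import Data.List.Relation.Unary.AllPairs using (AllPairs)
open import Data.List.Membership.Propositional using (_∈_)
open import Data.Product using (_×_; _,_; proj₁; proj₂; ∃; ∃-syntax)
open import Relation.Nullary using (¬_; ¬?)
open import Relation.Binary.PropositionalEquality using (_≡_; _≢_)

-- A coordinate entry z_j: a parameter t (a label in ℕ) together with a Bool
-- offset: false means  t , true means  t+1 .
-- Parameters are attached to their coordinate: the parameter of entry j is
-- the pair (j , label), so parameters in different coordinates are distinct.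
Entry : Set
Entry = ℕ × Bool

param : Entry → ℕ
param = proj₁

Cube : ℕ → Set
Cube n = Fin n → Entry

NonOverlap : ∀ {n} → Cube n → Cube n → Set
NonOverlap {n} z z' =
  ∃[ j ] (param (z j) ≡ param (z' j) × proj₂ (z j) ≢ proj₂ (z' j))

-- A packing: a finite family of pairwise non-overlapping cubes
-- (pairwise non-overlap also forces the cubes to be distinct).
IsPacking : ∀ {n} → List (Cube n) → Set
IsPacking CP = AllPairs NonOverlap CP

NonExtensible : ∀ n → List (Cube n) → Set
NonExtensible n CP =
  IsPacking CP × length CP < 2 ^ n ×
  (∀ (C : Cube n) → ¬ All (NonOverlap C) CP)

OccursIn : ∀ {n} → Fin n → ℕ → List (Cube n) → Set
OccursIn j t CP = Any (λ D → param (D j) ≡ t) CP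

newParams : ∀ {n} → Cube n → List (Cube n) → ℕ
newParams {n} C CP =
  length (filter (λ j → ¬? (any? (λ D → param (D j) ≟ param (C j)) CP)) (allFin n))

module Submission where

-- Non-overlap of two cubes is witnessed at a single coordinate, so it survives
-- every modification of a cube away from that coordinate.  Both parts of the
-- theorem build a cube avoiding the whole packing by such modifications,
-- contradicting non-extensibility.
--
-- (i)  If (t+1) never occurs at the parameter (j , t) while a cube C has t
--      there, flip C at j.  The flipped cube avoids C at j, and it avoids every
--      other cube D: a witness of C against D lies off j (and survives), or lies
--      at j, which would force D j = t+1.
-- (ii) If C has at least k new parameters, set the i-th new coordinate of C to
--      the opposite of the i-th removed cube's entry there ('oppose').  New
--      coordinates never witness non-overlap with CP', so C still avoids CP',
--      and each removed cube is avoided at its own coordinate; the result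
--      avoids CP' ++ Rem, a permutation of CP.

open import Defs
open import Data.Nat using (ℕ; _<_; _≤_; s≤s)
open import Data.Nat.Properties using (_≤?_; ≰⇒>)
import Data.Nat.Properties as ℕ
open import Data.Bool using (true; false; not)
import Data.Bool.Properties as Bool
open import Data.Fin using (Fin)
import Data.Fin.Properties as Fin
open import Data.Vec.Functional using (updateAt)
open import Data.Vec.Functional.Properties using (updateAt-updates; updateAt-minimal)
open import Data.List using (List; []; _∷_; length; _++_; filter; allFin)
open import Data.List.Relation.Unary.All as All using (All; []; _∷_; tabulate)
open import Data.List.Relation.Unary.All.Properties using (++⁺)
open import Data.List.Relation.Unary.Any using (here; there; any?)
open import Data.List.Membership.Propositional using (_∈_; _∉_; find; lose)
open import Data.List.Membership.Propositional.Properties using (∈-filter⁻; ∈-AllPairs₂)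
open import Data.List.Relation.Binary.Permutation.Propositional using (_↭_; ↭-sym)
open import Data.List.Relation.Binary.Permutation.Propositional.Properties using (All-resp-↭)
open import Data.List.Relation.Unary.Unique.Propositional using (Unique; []; _∷_)
open import Data.List.Relation.Unary.Unique.Propositional.Properties using (allFin⁺; filter⁺)
open import Data.Product using (_×_; _,_; ∃-syntax; proj₂)
open import Data.Product.Properties using (≡-dec)
open import Data.Sum using (_⊎_; inj₁; inj₂)
open import Data.Empty using (⊥-elim)
open import Function using (const)
open import Relation.Unary using (Decidable)
open import Relation.Nullary using (¬_; yes; no; ¬?; contradiction)
open import Relation.Binary.Definitions using (DecidableEquality)
open import Relation.Binary.PropositionalEquality using (_≡_; _≢_; refl; sym; trans; cong)

_≟ₑ_ : DecidableEquality Entry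
_≟ₑ_ = ≡-dec ℕ._≟_ Bool._≟_

opposite : Entry → Entry
opposite (t , b) = (t , not b)

Apart : Entry → Entry → Set
Apart e e' = param e ≡ param e' × proj₂ e ≢ proj₂ e'

NonOverlapAt : ∀ {n} → Cube n → Cube n → Fin n → Set
NonOverlapAt z z' j = Apart (z j) (z' j)

-- Non-overlap is symmetric (the packing stores each pair in one order only).
nonOverlap-sym : ∀ {n} {z z' : Cube n} → NonOverlap z z' → NonOverlap z' z
nonOverlap-sym (j , same , differ) = j , sym same , λ e → differ (sym e)

opposite-apart : ∀ {e} (d : Entry) → e ≡ opposite d → Apart e d
opposite-apart (t , b) refl = refl , λ e → Bool.not-¬ refl (sym e)

-- Being apart from d only depends on the entry itself; replacing it by an
-- equal one is how witnesses survive updates at other coordinates.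
apart-resp : ∀ {e e'} (d : Entry) → e' ≡ e → Apart e d → Apart e' d
apart-resp d refl w = w

nonOverlap-updateAt : ∀ {n} {C D : Cube n} j (f : Entry → Entry) →
  NonOverlap C D → NonOverlap (updateAt C j f) D ⊎ NonOverlapAt C D j
nonOverlap-updateAt {C = C} {D} j f (i , w) with i Fin.≟ j
... | yes refl = inj₂ w
... | no i≢j   = inj₁ (i , apart-resp (D i) (updateAt-minimal i j C i≢j) w)

packing-nonOverlap : ∀ {n} {CP : List (Cube n)} {C D} → IsPacking CP →
  C ∈ CP → D ∈ CP → C ≢ D → NonOverlap C D
packing-nonOverlap packing C∈ D∈ C≢D with ∈-AllPairs₂ packing C∈ D∈
... | inj₁ C≡D        = contradiction C≡D C≢D
... | inj₂ (inj₁ w)   = w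
... | inj₂ (inj₂ w)   = nonOverlap-sym w

partner-of-lower : ∀ {t} (e : Entry) → param e ≡ t → proj₂ e ≢ false → e ≡ (t , true)
partner-of-lower (t , false) refl ≢false = contradiction refl ≢false
partner-of-lower (t , true)  refl ≢false = refl

upper-occurs : ∀ {n} {CP : List (Cube n)} → IsPacking CP →
  (∀ (C : Cube n) → ¬ All (NonOverlap C) CP) →
  ∀ (j : Fin n) (t : ℕ) → (∃[ C ] (C ∈ CP × C j ≡ (t , false))) →
  ∃[ D ] (D ∈ CP × D j ≡ (t , true))
upper-occurs {n} {CP} packing maximal j t (C , C∈ , Cj≡)
  with any? (λ D → D j ≟ₑ (t , true)) CP
... | yes upper = find upper
... | no noUpper = ⊥-elim (maximal flipped (tabulate avoids))
  where
  flipped : Cube n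
  flipped = updateAt C j opposite

  avoids : ∀ {D} → D ∈ CP → NonOverlap flipped D
  avoids {D} D∈ with D j ≟ₑ (t , false)
  ... | yes Dj≡ = j , opposite-apart (D j)
                        (trans (updateAt-updates j C) (cong opposite (trans Cj≡ (sym Dj≡))))
  ... | no Dj≢ with nonOverlap-updateAt j opposite
                      (packing-nonOverlap packing C∈ D∈ (λ { refl → Dj≢ Cj≡ }))
  ...   | inj₁ w = w
  ...   | inj₂ (same , differ) = contradiction (lose D∈ upper) noUpper
    where
    upper : D j ≡ (t , true)
    upper = partner-of-lower (D j) (trans (sym same) (cong param Cj≡))
                             (λ e → differ (trans (cong proj₂ Cj≡) (sym e)))

isNew? : ∀ {n} (C : Cube n) (CP : List (Cube n)) →
  Decidable (λ (j : Fin n) → ¬ OccursIn j (param (C j)) CP)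
isNew? C CP j = ¬? (any? (λ D → param (D j) ℕ.≟ param (C j)) CP)

newCoords : ∀ {n} → Cube n → List (Cube n) → List (Fin n)
newCoords {n} C CP = filter (isNew? C CP) (allFin n)

newCoords-unique : ∀ {n} (C : Cube n) CP → Unique (newCoords C CP)
newCoords-unique {n} C CP = filter⁺ _ (allFin⁺ n)

witness-not-new : ∀ {n} {C D : Cube n} {CP i} → D ∈ CP →
  NonOverlapAt C D i → i ∉ newCoords C CP
witness-not-new {n} {C} {CP = CP} D∈ (same , _) i∈ =
  proj₂ (∈-filter⁻ (isNew? C CP) {xs = allFin n} i∈) (lose D∈ (sym same))

oppose : ∀ {n} → Cube n → List (Fin n) → List (Cube n) → Cube n
oppose C (j ∷ S) (R ∷ Rs) = updateAt (oppose C S Rs) j (const (opposite (R j)))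
oppose C (j ∷ S) []       = C
oppose C []      Rs       = C

oppose-outside : ∀ {n} (C : Cube n) S Rs {i} → i ∉ S → oppose C S Rs i ≡ C i
oppose-outside C (j ∷ S) (R ∷ Rs) {i} i∉ =
  trans (updateAt-minimal i j (oppose C S Rs) (λ i≡j → i∉ (here i≡j)))
        (oppose-outside C S Rs (λ i∈ → i∉ (there i∈)))
oppose-outside C (j ∷ S) []       i∉ = refl
oppose-outside C []      Rs       i∉ = refl

oppose-avoids : ∀ {n} (C : Cube n) S Rs → Unique S → length Rs ≤ length S →
  All (λ R → ∃[ i ] (i ∈ S × NonOverlapAt (oppose C S Rs) R i)) Rs
oppose-avoids C S       []       _           _         = []
oppose-avoids C (j ∷ S) (R ∷ Rs) (j∉S ∷ uS) (s≤s len) =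
  (j , here refl , opposite-apart (R j) (updateAt-updates j (oppose C S Rs)))
  ∷ All.map keep (oppose-avoids C S Rs uS len)
  where
  keep : ∀ {R'} → ∃[ i ] (i ∈ S × NonOverlapAt (oppose C S Rs) R' i) →
    ∃[ i ] (i ∈ j ∷ S × NonOverlapAt (oppose C (j ∷ S) (R ∷ Rs)) R' i)
  keep {R'} (i , i∈ , w) = i , there i∈ , apart-resp (R' i) unchanged w
    where
    unchanged : oppose C (j ∷ S) (R ∷ Rs) i ≡ oppose C S Rs i
    unchanged = updateAt-minimal i j (oppose C S Rs) (λ { refl → All.lookup j∉S i∈ refl })

avoid-removed : ∀ {n} (C : Cube n) (CP' Rem : List (Cube n)) →
  All (NonOverlap C) CP' → length Rem ≤ newParams C CP' →
  ∃[ C' ] All (NonOverlap C') (CP' ++ Rem)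
avoid-removed C CP' Rem avoidsCP' len =
  C' , ++⁺ (tabulate keep)
           (All.map (λ { (i , _ , w) → i , w })
                    (oppose-avoids C S Rem (newCoords-unique C CP') len))
  where
  S : List (Fin _)
  S = newCoords C CP'

  C' : Cube _
  C' = oppose C S Rem

  keep : ∀ {D} → D ∈ CP' → NonOverlap C' D
  keep {D} D∈ with All.lookup avoidsCP' D∈
  ... | (i , w) = i , apart-resp (D i) (oppose-outside C S Rem (witness-not-new {C = C} D∈ w)) w

newParams-bound : ∀ {n} {CP : List (Cube n)} →
  (∀ (C : Cube n) → ¬ All (NonOverlap C) CP) →
  ∀ (Rem CP' : List (Cube n)) → CP ↭ CP' ++ Rem →
  ∀ (C : Cube n) → All (NonOverlap C) CP' → newParams C CP' < length Rem
newParams-bound maximal Rem CP' perm C avoidsCP' with length Rem ≤? newParams C CP'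
... | no  more = ≰⇒> more
... | yes len with avoid-removed C CP' Rem avoidsCP' len
...   | C' , avoidsAll = ⊥-elim (maximal C' (All-resp-↭ (↭-sym perm) avoidsAll))

lemma5 : ∀ (n : ℕ) (CP : List (Cube n)) → NonExtensible n CP →
    (∀ (j : Fin n) (t : ℕ) → (∃[ C ] (C ∈ CP × C j ≡ (t , false))) →
    ∃[ D ] (D ∈ CP × D j ≡ (t , true)))
    ×
    (∀ (Rem CP' : List (Cube n)) → CP ↭ CP' ++ Rem →
    ∀ (C : Cube n) → All (NonOverlap C) CP' →
    newParams C CP' < length Rem)
lemma5 n CP (packing , _ , maximal) =
  upper-occurs packing maximal , newParams-bound maximal
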